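{- Let $\mathcal{B}$ be the free strict monoidal category generated by one object $1$ and morphisms $\mu:2\to1$, $\eta:0\to1$, $\delta:1\to2$, $\varepsilon:1\to0$, $\gamma:2\to2$, let $\equiv$ be the congruence generated by the twenty-two relations of bicommutative bialgebras (in the context), and let $I:\mathcal{B}\to\mathbf{MRel}$ be the strict monoidal functor with $I(1)=1$, $I(\mu)=R^\mu$, $I(\eta)=R^\eta$, $I(\delta)=R^\delta$, $I(\varepsilon)=R^\varepsilon$, $I(\gamma)=R^\gamma$. Then $I$ induces a functor $\mathcal{B}/\!\equiv\;\to\mathbf{MRel}$, and this functor is full.
   Context: $\mathbf{MRel}$: objects are natural numbers (finite ordinals $n=\{0,\dots,n-1\}$), morphisms $R:m\to n$ are functions $m\times n\to\mathbb{N}$, composition $(R_2\circ R_1)(a,c)=\sum_b R_1(a,b)R_2(b,c)$, tensor is disjoint union (block-diagonal sum). $R^\mu:2\to1$ has $R^\mu(0,0)=R^\mu(1,0)=1$; $R^\delta:1\to2$ has $R^\delta(0,0)=R^\delta(0,1)=1$; $R^\eta:0\to1$ and $R^\varepsilon:1\to0$ are the empty multirelations; $R^\gamma:2\to2$ has $R^\gamma(0,1)=R^\gamma(1,0)=1$ and $R^\gamma(0,0)=R^\gamma(1,1)=0$. Writing $X=\mathrm{id}_1$, the relations generating $\equiv$ are: $(\gamma\otimes X)(X\otimes\gamma)(\gamma\otimes X)=(X\otimes\gamma)(\gamma\otimes X)(X\otimes\gamma)$; $\gamma\gamma=\mathrm{id}_2$; $\mu(\mu\otimes X)=\mu(X\otimes\mu)$;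 $\mu(\eta\otimes X)=X=\mu(X\otimes\eta)$; $\gamma(\mu\otimes X)=(X\otimes\mu)(\gamma\otimes X)(X\otimes\gamma)$; $\gamma(X\otimes\mu)=(\mu\otimes X)(X\otimes\gamma)(\gamma\otimes X)$; $\gamma(\eta\otimes X)=X\otimes\eta$; $\gamma(X\otimes\eta)=\eta\otimes X$; $\mu\gamma=\mu$; $(\delta\otimes X)\delta=(X\otimes\delta)\delta$; $(\varepsilon\otimes X)\delta=X=(X\otimes\varepsilon)\delta$; $(\delta\otimes X)\gamma=(X\otimes\gamma)(\gamma\otimes X)(X\otimes\delta)$; $(X\otimes\delta)\gamma=(\gamma\otimes X)(X\otimes\gamma)(\delta\otimes X)$; $(\varepsilon\otimes X)\gamma=X\otimes\varepsilon$; $(X\otimes\varepsilon)\gamma=\varepsilon\otimes X$; $\gamma\delta=\delta$; $\delta\mu=(\mu\otimes\mu)(X\otimes\gamma\otimes X)(\delta\otimes\delta)$; $\varepsilon\mu=\varepsilon\otimes\varepsilon$; $\delta\eta=\eta\otimes\eta$; $\varepsilon\eta=\mathrm{id}_0$ (juxtaposition denotes composition). -}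

module Defs where

open import Data.Nat using (ℕ; zero; suc; _+_; _*_)
open import Data.Nat.Properties using (+-assoc; +-identityʳ)
open import Data.Fin using (Fin; splitAt; _≟_)
import Data.Fin as F
open import Data.Sum using (_⊎_; inj₁; inj₂)
open import Data.Bool using (if_then_else_)
open import Relation.Nullary.Decidable using (⌊_⌋)
open import Relation.Binary.PropositionalEquality using (_≡_; subst₂)

MRel : ℕ → ℕ → Set
MRel m n = Fin m → Fin n → ℕ

sumFin : (n : ℕ) → (Fin n → ℕ) → ℕ
sumFin zero    f = 0
sumFin (suc n) f = f F.zero + sumFin n (λ b → f (F.suc b))

idR : (n : ℕ) → MRel n n
idR n a b = if ⌊ a ≟ b ⌋ then 1 else 0

-- composition: (S ∘ R)(a,c) = Σ_b R(a,b) S(b,c)   (R first, then S)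
_∘R_ : ∀ {m n p} → MRel n p → MRel m n → MRel m p
_∘R_ {n = n} S R a c = sumFin n (λ b → R a b * S b c)

_⊗R_ : ∀ {m n p q} → MRel m n → MRel p q → MRel (m + p) (n + q)
_⊗R_ {m} {n} R S a b with splitAt m a | splitAt n b
... | inj₁ a' | inj₁ b' = R a' b'
... | inj₂ a' | inj₂ b' = S a' b'
... | inj₁ _  | inj₂ _  = 0
... | inj₂ _  | inj₁ _  = 0

_≐_ : ∀ {m n} → MRel m n → MRel m n → Set
R ≐ S = ∀ a b → R a b ≡ S a b

Rμ : MRel 2 1
Rμ _ _ = 1

Rδ : MRel 1 2
Rδ _ _ = 1

Rη : MRel 0 1
Rη ()

Rε : MRel 1 0
Rε _ ()

Rγ : MRel 2 2
Rγ a b = if ⌊ a ≟ b ⌋ then 0 else 1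

-- Terms of the free strict monoidal category 𝓑 on one object 1
-- (object n = 1 ⊗ ... ⊗ 1, n copies) and generators μ η δ ε γ.

infixr 9 _∘_
infixr 8 _⊗_

data Term : ℕ → ℕ → Set where
  id  : (n : ℕ) → Term n n
  _∘_ : ∀ {m n p} → Term n p → Term m n → Term m p      -- g ∘ f : f first
  _⊗_ : ∀ {m n p q} → Term m n → Term p q → Term (m + p) (n + q)
  μ   : Term 2 1
  η   : Term 0 1
  δ   : Term 1 2
  ε   : Term 1 0
  γ   : Term 2 2

X : Term 1 1
X = id 1

-- The congruence ≡ of the statement: the strict monoidal category
-- axioms (so that Term / ≈ is the free strict monoidal category 𝓑)
-- together with the 22 bicommutative-bialgebra relations.
infix 4 _≈_
data _≈_ : ∀ {m n} → Term m n → Term m n → Set where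
  ≈-refl  : ∀ {m n} {f : Term m n} → f ≈ f
  ≈-sym   : ∀ {m n} {f g : Term m n} → f ≈ g → g ≈ f
  ≈-trans : ∀ {m n} {f g h : Term m n} → f ≈ g → g ≈ h → f ≈ h
  ∘-cong  : ∀ {m n p} {g g' : Term n p} {f f' : Term m n} →
            g ≈ g' → f ≈ f' → g ∘ f ≈ g' ∘ f'
  ⊗-cong  : ∀ {m n p q} {f f' : Term m n} {g g' : Term p q} →
            f ≈ f' → g ≈ g' → f ⊗ g ≈ f' ⊗ g'
  ∘-assoc : ∀ {m n p r} {h : Term p r} {g : Term n p} {f : Term m n} →
            (h ∘ g) ∘ f ≈ h ∘ (g ∘ f)
  ∘-idˡ   : ∀ {m n} {f : Term m n} → id n ∘ f ≈ f
  ∘-idʳ   : ∀ {m n} {f : Term m n} → f ∘ id m ≈ f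
  ⊗-id    : ∀ {m n} → id m ⊗ id n ≈ id (m + n)
  interchange : ∀ {m n p q r s} {f : Term n p} {f' : Term m n}
                  {g : Term r s} {g' : Term q r} →
                (f ⊗ g) ∘ (f' ⊗ g') ≈ (f ∘ f') ⊗ (g ∘ g')
  ⊗-unitˡ : ∀ {m n} {f : Term m n} → id 0 ⊗ f ≈ f
  ⊗-unitʳ : ∀ {m n} {f : Term m n} →
            subst₂ Term (+-identityʳ m) (+-identityʳ n) (f ⊗ id 0) ≈ f
  ⊗-assoc : ∀ {m n p q r s} {f : Term m n} {g : Term p q} {h : Term r s} →
            subst₂ Term (+-assoc m p r) (+-assoc n q s) ((f ⊗ g) ⊗ h)
              ≈ f ⊗ (g ⊗ h)
  r1  : (γ ⊗ X) ∘ (X ⊗ γ) ∘ (γ ⊗ X) ≈ (X ⊗ γ) ∘ (γ ⊗ X) ∘ (X ⊗ γ)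
  r2  : γ ∘ γ ≈ id 2
  r3  : μ ∘ (μ ⊗ X) ≈ μ ∘ (X ⊗ μ)
  r4  : μ ∘ (η ⊗ X) ≈ X
  r5  : μ ∘ (X ⊗ η) ≈ X
  r6  : γ ∘ (μ ⊗ X) ≈ (X ⊗ μ) ∘ (γ ⊗ X) ∘ (X ⊗ γ)
  r7  : γ ∘ (X ⊗ μ) ≈ (μ ⊗ X) ∘ (X ⊗ γ) ∘ (γ ⊗ X)
  r8  : γ ∘ (η ⊗ X) ≈ X ⊗ η
  r9  : γ ∘ (X ⊗ η) ≈ η ⊗ X
  r10 : μ ∘ γ ≈ μ
  r11 : (δ ⊗ X) ∘ δ ≈ (X ⊗ δ) ∘ δ
  r12 : (ε ⊗ X) ∘ δ ≈ X
  r13 : (X ⊗ ε) ∘ δ ≈ X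
  r14 : (δ ⊗ X) ∘ γ ≈ (X ⊗ γ) ∘ (γ ⊗ X) ∘ (X ⊗ δ)
  r15 : (X ⊗ δ) ∘ γ ≈ (γ ⊗ X) ∘ (X ⊗ γ) ∘ (δ ⊗ X)
  r16 : (ε ⊗ X) ∘ γ ≈ X ⊗ ε
  r17 : (X ⊗ ε) ∘ γ ≈ ε ⊗ X
  r18 : γ ∘ δ ≈ δ
  r19 : δ ∘ μ ≈ (μ ⊗ μ) ∘ (X ⊗ γ ⊗ X) ∘ (δ ⊗ δ)
  r20 : ε ∘ μ ≈ ε ⊗ ε
  r21 : δ ∘ η ≈ η ⊗ η
  r22 : ε ∘ η ≈ id 0

I : ∀ {m n} → Term m n → MRel m n
I (id n)  = idR n
I (g ∘ f) = I g ∘R I f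
I (f ⊗ g) = I f ⊗R I g
I μ = Rμ
I η = Rη
I δ = Rδ
I ε = Rε
I γ = Rγ

module Submission where

-- Soundness: I respects ≈.  Since ≈ is generated inductively, it suffices
-- that MRel is a strict monoidal category (composition of ℕ-matrices is
-- associative and unital; the block-diagonal sum is functorial,
-- associative and unital) and that the 22 bialgebra relations hold; the
-- latter are equalities between small closed matrices, decided by evaluation.
--
-- Fullness: every ℕ-matrix R : m → n is the image of a term, built one row
-- at a time as  R = absorb (R 0) ∘ (X ⊗ R'),  where R' is R without its
-- first row and  absorb r : 1 + n → n  adds r-weighted copies of its first
-- wire to the other n wires.  absorb r is built wire by wire from
-- feed c : (x , y) ↦ (y + c·x , x),  which is γ followed by c shears
-- (x , y) ↦ (x , x + y).

open import Defs
open import Data.Nat using (ℕ; zero; suc; _+_; _*_)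
open import Data.Nat.Properties
  using (+-assoc; +-identityʳ; *-identityʳ; *-zeroʳ; *-assoc; *-comm; +-comm; +-*-semiring)
  renaming (_≟_ to _≟ℕ_)
open import Data.Fin using (Fin; zero; suc; _↑ˡ_; _↑ʳ_; splitAt; toℕ; _≟_)
open import Data.Fin.Properties
  using (splitAt-↑ˡ; splitAt-↑ʳ; toℕ-injective; toℕ-↑ˡ; toℕ-↑ʳ; all?;
         suc-injective; ↑ˡ-injective; ↑ʳ-injective)
open import Data.Product using (_×_; Σ; _,_)
open import Function using (_∘′_)
open import Function.Definitions using (Injective)
open import Relation.Binary.PropositionalEquality
open import Relation.Nullary using (yes; no; Dec; contradiction)
open import Relation.Nullary.Decidable using (True; toWitness)
open import Algebra.Properties.Semiring.Sum +-*-semiring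
  using (sum; sum-cong-≗; ∑-comm; *-distribˡ-sum; *-distribʳ-sum)

open ≡-Reasoning

-- sumFin is the library's finite sum over the semiring ℕ; this lets us
-- reuse the library's distributivity and Fubini lemmas.
sumFin≡sum : ∀ n (f : Fin n → ℕ) → sumFin n f ≡ sum f
sumFin≡sum zero    f = refl
sumFin≡sum (suc n) f = cong (f zero +_) (sumFin≡sum n (f ∘′ suc))

sum-cong : ∀ n {f g : Fin n → ℕ} → (∀ i → f i ≡ g i) → sumFin n f ≡ sumFin n g
sum-cong n {f} {g} f≗g = begin
  sumFin n f ≡⟨ sumFin≡sum n f ⟩
  sum f      ≡⟨ sum-cong-≗ f≗g ⟩
  sum g      ≡⟨ sumFin≡sum n g ⟨
  sumFin n g ∎

sum-zero : ∀ n {f : Fin n → ℕ} → (∀ i → f i ≡ 0) → sumFin n f ≡ 0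
sum-zero zero    f≗0 = refl
sum-zero (suc n) f≗0 = cong₂ _+_ (f≗0 zero) (sum-zero n (λ i → f≗0 (suc i)))

sum-split : ∀ m n (f : Fin (m + n) → ℕ) →
  sumFin (m + n) f ≡ sumFin m (λ i → f (i ↑ˡ n)) + sumFin n (λ j → f (m ↑ʳ j))
sum-split zero    n f = refl
sum-split (suc m) n f =
  trans (cong (f zero +_) (sum-split m n (λ i → f (suc i)))) (sym (+-assoc (f zero) _ _))

sum-prefix : ∀ m n (f : Fin (m + n) → ℕ) → (∀ j → f (m ↑ʳ j) ≡ 0) →
  sumFin (m + n) f ≡ sumFin m (λ i → f (i ↑ˡ n))
sum-prefix m n f tail≗0 =
  trans (sum-split m n f) (trans (cong (sumFin m (λ i → f (i ↑ˡ n)) +_) (sum-zero n tail≗0)) (+-identityʳ _))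

sum-head : ∀ n (f : Fin (suc n) → ℕ) → (∀ i → f (suc i) ≡ 0) → sumFin (suc n) f ≡ f zero
sum-head n f tail≗0 = trans (sum-prefix 1 n f tail≗0) (+-identityʳ (f zero))

sum-*ˡ : ∀ n c (f : Fin n → ℕ) → c * sumFin n f ≡ sumFin n (λ i → c * f i)
sum-*ˡ n c f = begin
  c * sumFin n f               ≡⟨ cong (c *_) (sumFin≡sum n f) ⟩
  c * sum f                    ≡⟨ *-distribˡ-sum c f ⟩
  sum (λ i → c * f i)          ≡⟨ sumFin≡sum n _ ⟨
  sumFin n (λ i → c * f i)     ∎

sum-*ʳ : ∀ n c (f : Fin n → ℕ) → sumFin n f * c ≡ sumFin n (λ i → f i * c)
sum-*ʳ n c f = begin
  sumFin n f * c               ≡⟨ cong (_* c) (sumFin≡sum n f) ⟩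
  sum f * c                    ≡⟨ *-distribʳ-sum c f ⟩
  sum (λ i → f i * c)          ≡⟨ sumFin≡sum n _ ⟨
  sumFin n (λ i → f i * c)     ∎

sum-comm : ∀ m n (f : Fin m → Fin n → ℕ) →
  sumFin m (λ i → sumFin n (f i)) ≡ sumFin n (λ j → sumFin m (λ i → f i j))
sum-comm m n f = begin
  sumFin m (λ i → sumFin n (f i))          ≡⟨ sum-cong m (λ i → sumFin≡sum n (f i)) ⟩
  sumFin m (λ i → sum (f i))               ≡⟨ sumFin≡sum m _ ⟩
  sum (λ i → sum (f i))                    ≡⟨ ∑-comm f ⟩
  sum (λ j → sum (λ i → f i j))            ≡⟨ sumFin≡sum n _ ⟨
  sumFin n (λ j → sum (λ i → f i j))       ≡⟨ sum-cong n (λ j → sumFin≡sum m _) ⟨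
  sumFin n (λ j → sumFin m (λ i → f i j))  ∎

idR-refl : ∀ {n} (a : Fin n) → idR n a a ≡ 1
idR-refl a with a ≟ a
... | yes _  = refl
... | no a≢a = contradiction refl a≢a

idR-apart : ∀ {n} {a b : Fin n} → a ≢ b → idR n a b ≡ 0
idR-apart {a = a} {b} a≢b with a ≟ b
... | yes a≡b = contradiction a≡b a≢b
... | no _    = refl

idR-injective : ∀ {m n} (f : Fin m → Fin n) → Injective _≡_ _≡_ f →
  ∀ i j → idR n (f i) (f j) ≡ idR m i j
idR-injective f f-inj i j with i ≟ j
... | yes refl = idR-refl (f i)
... | no i≢j   = idR-apart (i≢j ∘′ f-inj)

idR-suc : ∀ n (i j : Fin n) → idR (suc n) (suc i) (suc j) ≡ idR n i j
idR-suc n = idR-injective suc suc-injective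

sum-δˡ : ∀ n (i : Fin n) (f : Fin n → ℕ) → sumFin n (λ b → idR n i b * f b) ≡ f i
sum-δˡ (suc n) zero    f =
  trans (sum-head n (λ b → idR (suc n) zero b * f b) (λ _ → refl)) (+-identityʳ (f zero))
sum-δˡ (suc n) (suc i) f = begin
  0 + sumFin n (λ b → idR (suc n) (suc i) (suc b) * f (suc b))
    ≡⟨ sum-cong n (λ b → cong (_* f (suc b)) (idR-suc n i b)) ⟩
  sumFin n (λ b → idR n i b * f (suc b))
    ≡⟨ sum-δˡ n i (f ∘′ suc) ⟩
  f (suc i) ∎

sum-δʳ : ∀ n (i : Fin n) (f : Fin n → ℕ) → sumFin n (λ b → f b * idR n b i) ≡ f i
sum-δʳ n i f = begin
  sumFin n (λ b → f b * idR n b i)  ≡⟨ sum-cong n (λ b → *-comm (f b) (idR n b i)) ⟩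
  sumFin n (λ b → idR n b i * f b)  ≡⟨ sum-cong n (λ b → cong (_* f b) (idR-sym b i)) ⟩
  sumFin n (λ b → idR n i b * f b)  ≡⟨ sum-δˡ n i f ⟩
  f i                               ∎
  where
  idR-sym : ∀ a b → idR n a b ≡ idR n b a
  idR-sym a b with a ≟ b
  ... | yes refl = sym (idR-refl a)
  ... | no a≢b   = sym (idR-apart (a≢b ∘′ sym))

data Block (m n : ℕ) : Fin (m + n) → Set where
  left  : (i : Fin m) → Block m n (i ↑ˡ n)
  right : (j : Fin n) → Block m n (m ↑ʳ j)

block : ∀ m n (a : Fin (m + n)) → Block m n a
block zero    n a       = right a
block (suc m) n zero    = left zero
block (suc m) n (suc a) with block m n a
... | left i  = left (suc i)
... | right j = right j

module _ {m n p q} (R : MRel m n) (S : MRel p q) where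
  ⊗-ll : ∀ i k → (R ⊗R S) (i ↑ˡ p) (k ↑ˡ q) ≡ R i k
  ⊗-ll i k rewrite splitAt-↑ˡ m i p | splitAt-↑ˡ n k q = refl
  ⊗-lr : ∀ i k → (R ⊗R S) (i ↑ˡ p) (n ↑ʳ k) ≡ 0
  ⊗-lr i k rewrite splitAt-↑ˡ m i p | splitAt-↑ʳ n q k = refl
  ⊗-rl : ∀ i k → (R ⊗R S) (m ↑ʳ i) (k ↑ˡ q) ≡ 0
  ⊗-rl i k rewrite splitAt-↑ʳ m p i | splitAt-↑ˡ n k q = refl
  ⊗-rr : ∀ i k → (R ⊗R S) (m ↑ʳ i) (n ↑ʳ k) ≡ S i k
  ⊗-rr i k rewrite splitAt-↑ʳ m p i | splitAt-↑ʳ n q k = refl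

block-ext : ∀ {m n p q} (T U : MRel (m + p) (n + q)) →
  (∀ i k → T (i ↑ˡ p) (k ↑ˡ q) ≡ U (i ↑ˡ p) (k ↑ˡ q)) →
  (∀ i k → T (i ↑ˡ p) (n ↑ʳ k) ≡ U (i ↑ˡ p) (n ↑ʳ k)) →
  (∀ i k → T (m ↑ʳ i) (k ↑ˡ q) ≡ U (m ↑ʳ i) (k ↑ˡ q)) →
  (∀ i k → T (m ↑ʳ i) (n ↑ʳ k) ≡ U (m ↑ʳ i) (n ↑ʳ k)) → T ≐ U
block-ext {m} {n} {p} {q} T U ll lr rl rr a b with block m p a | block n q b
... | left i  | left k  = ll i k
... | left i  | right k = lr i k
... | right i | left k  = rl i k
... | right i | right k = rr i k

↑ˡ≢↑ʳ : ∀ {m n} (i : Fin m) (j : Fin n) → i ↑ˡ n ≢ m ↑ʳ j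
↑ˡ≢↑ʳ {m} {n} i j eq with trans (sym (splitAt-↑ˡ m i n)) (trans (cong (splitAt m) eq) (splitAt-↑ʳ m n j))
... | ()

∘R-cong : ∀ {m n p} {S S' : MRel n p} {R R' : MRel m n} → S ≐ S' → R ≐ R' → (S ∘R R) ≐ (S' ∘R R')
∘R-cong {n = n} S≐S' R≐R' a c = sum-cong n (λ b → cong₂ _*_ (R≐R' a b) (S≐S' b c))

⊗R-cong : ∀ {m n p q} {R R' : MRel m n} {S S' : MRel p q} → R ≐ R' → S ≐ S' → (R ⊗R S) ≐ (R' ⊗R S')
⊗R-cong {R = R} {R'} {S} {S'} R≐R' S≐S' = block-ext _ _
  (λ i k → trans (⊗-ll R S i k) (trans (R≐R' i k) (sym (⊗-ll R' S' i k))))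
  (λ i k → trans (⊗-lr R S i k) (sym (⊗-lr R' S' i k)))
  (λ i k → trans (⊗-rl R S i k) (sym (⊗-rl R' S' i k)))
  (λ i k → trans (⊗-rr R S i k) (trans (S≐S' i k) (sym (⊗-rr R' S' i k))))

∘R-assoc : ∀ {m n p r} (H : MRel p r) (G : MRel n p) (F : MRel m n) →
  ((H ∘R G) ∘R F) ≐ (H ∘R (G ∘R F))
∘R-assoc {m} {n} {p} {r} H G F a d = begin
  sumFin n (λ b → F a b * sumFin p (λ c → G b c * H c d))
    ≡⟨ sum-cong n (λ b → sum-*ˡ p (F a b) _) ⟩
  sumFin n (λ b → sumFin p (λ c → F a b * (G b c * H c d)))
    ≡⟨ sum-comm n p _ ⟩
  sumFin p (λ c → sumFin n (λ b → F a b * (G b c * H c d)))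
    ≡⟨ sum-cong p (λ c → sum-cong n (λ b → *-assoc (F a b) (G b c) (H c d))) ⟨
  sumFin p (λ c → sumFin n (λ b → F a b * G b c * H c d))
    ≡⟨ sum-cong p (λ c → sum-*ʳ n (H c d) _) ⟨
  sumFin p (λ c → sumFin n (λ b → F a b * G b c) * H c d) ∎

∘R-identityˡ : ∀ {m n} (F : MRel m n) → (idR n ∘R F) ≐ F
∘R-identityˡ {n = n} F a b = sum-δʳ n b (F a)

∘R-identityʳ : ∀ {m n} (F : MRel m n) → (F ∘R idR m) ≐ F
∘R-identityʳ {m} F a b = sum-δˡ m a (λ c → F c b)

⊗R-identity : ∀ m n → (idR m ⊗R idR n) ≐ idR (m + n)
⊗R-identity m n = block-ext _ _
  (λ i k → trans (⊗-ll (idR m) (idR n) i k) (sym (idR-injective (_↑ˡ n) (↑ˡ-injective n _ _) i k)))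
  (λ i k → trans (⊗-lr (idR m) (idR n) i k) (sym (idR-apart (↑ˡ≢↑ʳ i k))))
  (λ i k → trans (⊗-rl (idR m) (idR n) i k) (sym (idR-apart (↑ˡ≢↑ʳ k i ∘′ sym))))
  (λ i k → trans (⊗-rr (idR m) (idR n) i k) (sym (idR-injective (m ↑ʳ_) (↑ʳ-injective m _ _) i k)))

module _ {m n p q r s} (F : MRel n p) (F' : MRel m n) (G : MRel r s) (G' : MRel q r) where
  private
    L  : MRel (n + r) (p + s)
    L' : MRel (m + q) (n + r)
    L  = F ⊗R G
    L' = F' ⊗R G'

    -- A row of the left (right) block of L' only meets the left (right)
    -- block of the middle object.
    rowˡ : ∀ i c → (L ∘R L') (i ↑ˡ q) c ≡ sumFin n (λ b → F' i b * L (b ↑ˡ r) c)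
    rowˡ i c = trans (sum-split n r _) (trans
      (cong₂ _+_ (sum-cong n (λ b → cong (_* L (b ↑ˡ r) c) (⊗-ll F' G' i b)))
                 (sum-zero r (λ j → cong (_* L (n ↑ʳ j) c) (⊗-lr F' G' i j))))
      (+-identityʳ _))

    rowʳ : ∀ i c → (L ∘R L') (m ↑ʳ i) c ≡ sumFin r (λ j → G' i j * L (n ↑ʳ j) c)
    rowʳ i c = trans (sum-split n r _)
      (cong₂ _+_ (sum-zero n (λ b → cong (_* L (b ↑ˡ r) c) (⊗-rl F' G' i b)))
                 (sum-cong r (λ j → cong (_* L (n ↑ʳ j) c) (⊗-rr F' G' i j))))

  interchangeR : (L ∘R L') ≐ ((F ∘R F') ⊗R (G ∘R G'))
  interchangeR = block-ext _ _
    (λ i k → trans (rowˡ i _) (trans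
      (sum-cong n (λ b → cong (F' i b *_) (⊗-ll F G b k)))
      (sym (⊗-ll (F ∘R F') (G ∘R G') i k))))
    (λ i k → trans (rowˡ i _) (trans
      (sum-zero n (λ b → trans (cong (F' i b *_) (⊗-lr F G b k)) (*-zeroʳ (F' i b))))
      (sym (⊗-lr (F ∘R F') (G ∘R G') i k))))
    (λ i k → trans (rowʳ i _) (trans
      (sum-zero r (λ j → trans (cong (G' i j *_) (⊗-rl F G j k)) (*-zeroʳ (G' i j))))
      (sym (⊗-rl (F ∘R F') (G ∘R G') i k))))
    (λ i k → trans (rowʳ i _) (trans
      (sum-cong r (λ j → cong (G' i j *_) (⊗-rr F G j k)))
      (sym (⊗-rr (F ∘R F') (G ∘R G') i k))))

I-subst : ∀ {m n m' n'} (eq₁ : m ≡ m') (eq₂ : n ≡ n') (t : Term m n) a b →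
  I (subst₂ Term eq₁ eq₂ t) a b ≡ I t (subst Fin (sym eq₁) a) (subst Fin (sym eq₂) b)
I-subst refl refl t a b = refl

subst-Fin-toℕ : ∀ {m m'} (eq : m ≡ m') (a : Fin m) (a' : Fin m') → toℕ a ≡ toℕ a' → subst Fin eq a ≡ a'
subst-Fin-toℕ refl a a' a≡a' = toℕ-injective a≡a'

⊗R-unitʳ : ∀ {m n} (R : MRel m n) (a : Fin m) (b : Fin n) →
  (R ⊗R idR 0) (subst Fin (sym (+-identityʳ m)) a) (subst Fin (sym (+-identityʳ n)) b) ≡ R a b
⊗R-unitʳ {m} {n} R a b = trans
  (cong₂ (R ⊗R idR 0) (subst-Fin-toℕ _ a (a ↑ˡ 0) (sym (toℕ-↑ˡ a 0)))
                      (subst-Fin-toℕ _ b (b ↑ˡ 0) (sym (toℕ-↑ˡ b 0))))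
  (⊗-ll R (idR 0) a b)

module Reassoc {m p r} (eq : m + (p + r) ≡ m + p + r) where
  ↑first : ∀ (i : Fin m) → subst Fin eq (i ↑ˡ (p + r)) ≡ (i ↑ˡ p) ↑ˡ r
  ↑first i = subst-Fin-toℕ eq _ _
    (trans (toℕ-↑ˡ i _) (sym (trans (toℕ-↑ˡ (i ↑ˡ p) r) (toℕ-↑ˡ i p))))

  ↑second : ∀ (j : Fin p) → subst Fin eq (m ↑ʳ (j ↑ˡ r)) ≡ (m ↑ʳ j) ↑ˡ r
  ↑second j = subst-Fin-toℕ eq _ _
    (trans (toℕ-↑ʳ m (j ↑ˡ r)) (trans (cong (m +_) (toℕ-↑ˡ j r))
      (sym (trans (toℕ-↑ˡ (m ↑ʳ j) r) (toℕ-↑ʳ m j)))))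

  ↑third : ∀ (k : Fin r) → subst Fin eq (m ↑ʳ (p ↑ʳ k)) ≡ (m + p) ↑ʳ k
  ↑third k = subst-Fin-toℕ eq _ _
    (trans (toℕ-↑ʳ m (p ↑ʳ k)) (trans (cong (m +_) (toℕ-↑ʳ p k))
      (trans (sym (+-assoc m p (toℕ k))) (sym (toℕ-↑ʳ (m + p) k)))))

data Block₃ (m p r : ℕ) : Fin (m + (p + r)) → Set where
  first  : (i : Fin m) → Block₃ m p r (i ↑ˡ (p + r))
  second : (j : Fin p) → Block₃ m p r (m ↑ʳ (j ↑ˡ r))
  third  : (k : Fin r) → Block₃ m p r (m ↑ʳ (p ↑ʳ k))

block₃ : ∀ m p r (a : Fin (m + (p + r))) → Block₃ m p r a
block₃ m p r a with block m (p + r) a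
... | left i = first i
... | right x with block p r x
...   | left j  = second j
...   | right k = third k

module _ {m n p q r s} (A : MRel m n) (B : MRel p q) (C : MRel r s)
         (e₁ : m + (p + r) ≡ m + p + r) (e₂ : n + (q + s) ≡ n + q + s) where
  private
    AB : MRel (m + p) (n + q)
    AB = A ⊗R B
    BC : MRel (p + r) (q + s)
    BC = B ⊗R C
    module Rows = Reassoc {m} {p} {r} e₁
    module Cols = Reassoc {n} {q} {s} e₂

    reindexed : ∀ {a b a' b'} → subst Fin e₁ a ≡ a' → subst Fin e₂ b ≡ b' →
      (AB ⊗R C) a' b' ≡ (A ⊗R BC) a b → (AB ⊗R C) (subst Fin e₁ a) (subst Fin e₂ b) ≡ (A ⊗R BC) a b
    reindexed refl refl eq = eq

  ⊗R-assoc : ∀ a b → (AB ⊗R C) (subst Fin e₁ a) (subst Fin e₂ b) ≡ (A ⊗R BC) a b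
  ⊗R-assoc a b with block₃ m p r a | block₃ n q s b
  ... | first i  | first k  = reindexed (Rows.↑first i) (Cols.↑first k)
    (trans (⊗-ll AB C _ _) (trans (⊗-ll A B i k) (sym (⊗-ll A BC i _))))
  ... | first i  | second k = reindexed (Rows.↑first i) (Cols.↑second k)
    (trans (⊗-ll AB C _ _) (trans (⊗-lr A B i k) (sym (⊗-lr A BC i _))))
  ... | first i  | third k  = reindexed (Rows.↑first i) (Cols.↑third k)
    (trans (⊗-lr AB C _ k) (sym (⊗-lr A BC i _)))
  ... | second j | first k  = reindexed (Rows.↑second j) (Cols.↑first k)
    (trans (⊗-ll AB C _ _) (trans (⊗-rl A B j k) (sym (⊗-rl A BC _ k))))
  ... | second j | second k = reindexed (Rows.↑second j) (Cols.↑second k)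
    (trans (⊗-ll AB C _ _) (trans (⊗-rr A B j k) (sym (trans (⊗-rr A BC _ _) (⊗-ll B C j k)))))
  ... | second j | third k  = reindexed (Rows.↑second j) (Cols.↑third k)
    (trans (⊗-lr AB C _ k) (sym (trans (⊗-rr A BC _ _) (⊗-lr B C j k))))
  ... | third j  | first k  = reindexed (Rows.↑third j) (Cols.↑first k)
    (trans (⊗-rl AB C j _) (sym (⊗-rl A BC _ k)))
  ... | third j  | second k = reindexed (Rows.↑third j) (Cols.↑second k)
    (trans (⊗-rl AB C j _) (sym (trans (⊗-rr A BC _ _) (⊗-rl B C j k))))
  ... | third j  | third k  = reindexed (Rows.↑third j) (Cols.↑third k)
    (trans (⊗-rr AB C j k) (sym (trans (⊗-rr A BC _ _) (⊗-rr B C j k))))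

-- Equality of two concrete matrices is decidable, so relations between
-- closed terms can be verified by evaluation.
≐-dec : ∀ {m n} (R S : MRel m n) → Dec (R ≐ S)
≐-dec R S = all? (λ a → all? (λ b → R a b ≟ℕ S a b))

by-evaluation : ∀ {m n} {R S : MRel m n} {_ : True (≐-dec R S)} → R ≐ S
by-evaluation {R = R} {S} {holds} = toWitness {a? = ≐-dec R S} holds

sound : ∀ {m n} {f g : Term m n} → f ≈ g → I f ≐ I g
sound ≈-refl              a b = refl
sound (≈-sym f≈g)         a b = sym (sound f≈g a b)
sound (≈-trans f≈g g≈h)   a b = trans (sound f≈g a b) (sound g≈h a b)
sound (∘-cong g≈g' f≈f')      = ∘R-cong (sound g≈g') (sound f≈f')
sound (⊗-cong f≈f' g≈g')      = ⊗R-cong (sound f≈f') (sound g≈g')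
sound (∘-assoc {h = h} {g} {f}) = ∘R-assoc (I h) (I g) (I f)
sound (∘-idˡ {f = f})         = ∘R-identityˡ (I f)
sound (∘-idʳ {f = f})         = ∘R-identityʳ (I f)
sound (⊗-id {m} {n})          = ⊗R-identity m n
sound (interchange {f = f} {f'} {g} {g'}) = interchangeR (I f) (I f') (I g) (I g')
sound ⊗-unitˡ             a b = refl
sound (⊗-unitʳ {m} {n} {f}) a b =
  trans (I-subst (+-identityʳ m) (+-identityʳ n) (f ⊗ id 0) a b) (⊗R-unitʳ (I f) a b)
sound (⊗-assoc {m} {n} {p} {q} {r} {s} {f} {g} {h}) a b =
  trans (I-subst (+-assoc m p r) (+-assoc n q s) ((f ⊗ g) ⊗ h) a b)
        (⊗R-assoc (I f) (I g) (I h) (sym (+-assoc m p r)) (sym (+-assoc n q s)) a b)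
sound r1  = by-evaluation
sound r2  = by-evaluation
sound r3  = by-evaluation
sound r4  = by-evaluation
sound r5  = by-evaluation
sound r6  = by-evaluation
sound r7  = by-evaluation
sound r8  = by-evaluation
sound r9  = by-evaluation
sound r10 = by-evaluation
sound r11 = by-evaluation
sound r12 = by-evaluation
sound r13 = by-evaluation
sound r14 = by-evaluation
sound r15 = by-evaluation
sound r16 = by-evaluation
sound r17 = by-evaluation
sound r18 = by-evaluation
sound r19 = by-evaluation
sound r20 = by-evaluation
sound r21 = by-evaluation
sound r22 = by-evaluation

shear : Term 2 2
shear = (X ⊗ μ) ∘ (δ ⊗ X)

shearMatrix : MRel 2 2
shearMatrix (suc _) zero = 0
shearMatrix _       _    = 1

shear-I : I shear ≐ shearMatrix
shear-I = by-evaluation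

-- feed c : (x , y) ↦ (y + c·x , x), the matrix [[c,1],[1,0]].  Starting
-- from the symmetry, each shear adds one more copy of x to y.
feed : ℕ → Term 2 2
feed zero    = γ
feed (suc c) = feed c ∘ shear

feedMatrix : ℕ → MRel 2 2
feedMatrix c zero    zero    = c
feedMatrix c zero    (suc _) = 1
feedMatrix c (suc _) zero    = 1
feedMatrix c (suc _) (suc _) = 0

feedMatrix-suc : ∀ c → (feedMatrix c ∘R shearMatrix) ≐ feedMatrix (suc c)
feedMatrix-suc c zero       zero       = trans (cong (_+ 1) (+-identityʳ c)) (+-comm c 1)
feedMatrix-suc c zero       (suc zero) = refl
feedMatrix-suc c (suc zero) zero       = refl
feedMatrix-suc c (suc zero) (suc zero) = refl

feed-I : ∀ c → I (feed c) ≐ feedMatrix c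
feed-I zero    = by-evaluation
feed-I (suc c) a b = trans (∘R-cong (feed-I c) shear-I a b) (feedMatrix-suc c a b)

-- absorb r : 1 + k → k  sends the first wire x and the others z
-- to  z + r·x,  i.e. its matrix has first row r below which sits the
-- identity.
absorb : ∀ k → (Fin k → ℕ) → Term (1 + k) k
absorb zero    r = ε
absorb (suc k) r = (X ⊗ absorb k (r ∘′ suc)) ∘ (feed (r zero) ⊗ id k)

-- The first row of absorb r is r: the first output of feed carries r₀·x
-- and x itself moves on to be absorbed into the remaining wires.
absorb-head : ∀ k r c → I (absorb k r) zero c ≡ r c
absorb-head (suc k) r c = begin
  I (absorb (suc k) r) zero c
    ≡⟨ sum-prefix 2 k (λ b → W zero b * V b c) (λ _ → refl) ⟩
  W zero zero * V zero c + (W zero (suc zero) * V (suc zero) c + 0)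
    ≡⟨ cong₂ (λ u v → u * V zero c + (v * V (suc zero) c + 0))
             (feed-I (r zero) zero zero) (feed-I (r zero) zero (suc zero)) ⟩
  r zero * V zero c + (V (suc zero) c + 0 + 0)
    ≡⟨ first-row c ⟩
  r c ∎
  where
  W : MRel (2 + k) (2 + k)
  W = I (feed (r zero) ⊗ id k)
  V : MRel (2 + k) (1 + k)
  V = I (X ⊗ absorb k (r ∘′ suc))
  first-row : ∀ c → r zero * V zero c + (V (suc zero) c + 0 + 0) ≡ r c
  first-row zero    = trans (+-identityʳ _) (*-identityʳ (r zero))
  first-row (suc c) = trans (cong₂ _+_ (*-zeroʳ (r zero)) (trans (+-identityʳ _) (+-identityʳ _)))
                            (absorb-head k (r ∘′ suc) c)

absorb-tail : ∀ k r i c → I (absorb k r) (suc i) c ≡ idR k i c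
absorb-tail (suc k) r zero c = begin
  I (absorb (suc k) r) (suc zero) c
    ≡⟨ sum-prefix 2 k (λ b → W (suc zero) b * V b c) (λ _ → refl) ⟩
  W (suc zero) zero * V zero c + (W (suc zero) (suc zero) * V (suc zero) c + 0)
    ≡⟨ cong₂ (λ u v → u * V zero c + (v * V (suc zero) c + 0))
             (feed-I (r zero) (suc zero) zero) (feed-I (r zero) (suc zero) (suc zero)) ⟩
  V zero c + 0 + 0
    ≡⟨ trans (+-identityʳ _) (+-identityʳ _) ⟩
  V zero c
    ≡⟨ kept c ⟩
  idR (suc k) zero c ∎
  where
  W : MRel (2 + k) (2 + k)
  W = I (feed (r zero) ⊗ id k)
  V : MRel (2 + k) (1 + k)
  V = I (X ⊗ absorb k (r ∘′ suc))
  kept : ∀ c → V zero c ≡ idR (suc k) zero c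
  kept zero    = refl
  kept (suc c) = refl
absorb-tail (suc k) r (suc i) c = begin
  sumFin k (λ j → idR k i j * V (suc (suc j)) c)
    ≡⟨ sum-δˡ k i (λ j → V (suc (suc j)) c) ⟩
  V (suc (suc i)) c
    ≡⟨ passed c ⟩
  idR (suc k) (suc i) c ∎
  where
  V : MRel (2 + k) (1 + k)
  V = I (X ⊗ absorb k (r ∘′ suc))
  passed : ∀ c → V (suc (suc i)) c ≡ idR (suc k) (suc i) c
  passed zero    = refl
  passed (suc c) = trans (absorb-tail k (r ∘′ suc) i c) (sym (idR-suc k i c))

zeros : ∀ n → Term 0 n
zeros zero    = id 0
zeros (suc n) = η ⊗ zeros n

realise : ∀ m n → MRel m n → Term m n
realise zero    n R = zeros n
realise (suc m) n R = absorb n (R zero) ∘ (X ⊗ realise m n (R ∘′ suc))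

realise-I : ∀ m n (R : MRel m n) → I (realise m n R) ≐ R
realise-I zero    n R () c
realise-I (suc m) n R zero c = begin
  sumFin (suc n) (λ b → U zero b * A b c)  ≡⟨ sum-head n (λ b → U zero b * A b c) (λ _ → refl) ⟩
  A zero c + 0                              ≡⟨ +-identityʳ _ ⟩
  A zero c                                  ≡⟨ absorb-head n (R zero) c ⟩
  R zero c                                  ∎
  where
  U : MRel (1 + m) (1 + n)
  U = I (X ⊗ realise m n (R ∘′ suc))
  A : MRel (1 + n) n
  A = I (absorb n (R zero))
realise-I (suc m) n R (suc i) c = begin
  sumFin n (λ b → F i b * A (suc b) c)  ≡⟨ sum-cong n (λ b → cong (F i b *_) (absorb-tail n (R zero) b c)) ⟩
  sumFin n (λ b → F i b * idR n b c)    ≡⟨ sum-δʳ n c (F i) ⟩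
  F i c                                 ≡⟨ realise-I m n (R ∘′ suc) i c ⟩
  R (suc i) c                           ∎
  where
  F : MRel m n
  F = I (realise m n (R ∘′ suc))
  A : MRel (1 + n) n
  A = I (absorb n (R zero))

mainTheorem4 : (∀ {m n} {f g : Term m n} → f ≈ g → I f ≐ I g)
               × (∀ (m n : ℕ) (R : MRel m n) → Σ (Term m n) (λ f → I f ≐ R))
mainTheorem4 = sound , λ m n R → realise m n R , realise-I m n R
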